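{- Let $G$ be a connected ribbon graph with a total order $\prec$ on $E(G)$, let $G^*$ be its dual with the induced total order $\prec^*$ (so $e^* \prec^* f^*$ iff $e \prec f$), let $Q$ be a quasi-tree of $G$ and let $Q^*$ be the spanning subgraph of $G^*$ with edge set $\{e^* : e \in E(G)\setminus E(Q)\}$ (which is a quasi-tree of $G^*$). Then, identifying $e$ with $e^*$: (1) $\mathcal{DI}(Q^*) = \mathcal{DE}(Q)$; (2) $\mathcal{I}_o(Q^*) = \mathcal{E}_o(Q)$; (3) $\mathcal{I}_n(Q^*) = \mathcal{E}_n(Q)$; (4) $\mathcal{DE}(Q^*) = \mathcal{DI}(Q)$; (5) $\mathcal{E}_o(Q^*) = \mathcal{I}_o(Q)$; (6) $\mathcal{E}_n(Q^*) = \mathcal{I}_n(Q)$.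
   Context: A ribbon graph is a compact surface with boundary decomposed into vertex discs and edge ribbons; $bc(\cdot)$ denotes the number of boundary components. A spanning subgraph contains all vertex discs and some edges; for $H\subseteq E(G)$, $F_H$ is the spanning subgraph with edge set $H$. The dual $G^*$ is obtained by gluing a disc to each boundary component of $G$ (these are the vertices of $G^*$) and deleting the vertex discs of $G$; each edge $e$ of $G$ corresponds to an edge $e^*$ of $G^*$. The partial dual $G^H$ is obtained by gluing a disc to each boundary curve of $F_H$ (these curves lie in $G$) and removing the interiors of the vertex discs of $G$; its edges correspond to those of $G$. A quasi-tree of $G$ is a spanning subgraph $Q$ with $bc(Q)=1$; then $G^{E(Q)}$ has exactly one vertex. Two edges $e,e'$ link (with respect to $Q$) if, traversing the boundary of the vertex of $G^{E(Q)}$, the attaching arcs of the ribbons $e$ and $e'$ are met alternately. Given a total order, an edge is live if it links no lower-ordered edge, and dead otherwise; it is internal if $e \in E(Q)$ and external otherwise; it is orientable (resp. nonorientable) if it forms an orientable (resp. nonorientable) loop in $G^{E(Q)}$. Notation: $\mathcal{DI}(Q)$ = internally dead edges, $\mathcal{I}_o(Q)$ = internally live orientable edges, $\mathcal{I}_n(Q)$ = internally live nonorientable edges, $\mathcal{DE}(Q)$ = externally dead edges, $\mathcal{E}_o(Q)$ = externally live orientable edges, $\mathcal{E}_n(Q)$ = externally live nonorientable edges. For $Q^*$ these sets are computed in $G^*$ with respect to $\prec^*$. -}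

module Defs where

open import Level using (0ℓ)
open import Data.Nat using (ℕ; zero; suc; _<_; _*_)
open import Data.Fin using (Fin)
open import Data.Fin.Subset using (Subset; _∈_; _∉_)
open import Data.Vec using (lookup)
open import Data.Bool using (Bool; true; false; not; if_then_else_)
open import Data.Product using (Σ; ∃; ∃-syntax; _×_; _,_)
open import Data.Sum using (_⊎_)
open import Relation.Binary using (Rel)
open import Relation.Binary.Construct.Closure.ReflexiveTransitive using (Star)
open import Relation.Binary.PropositionalEquality
open import Relation.Nullary using (¬_)

-- An edge ribbon i meets vertex discs in two attaching arcs ("ends",
-- indexed by a Bool); each attaching arc has two corners ("sides",
-- indexed by a Bool).  A flag is such a corner: (edge , end , side).
--  * swSide x : the other corner of the same attaching arc;
--  * swEnd  x : the corner joined to x by a side of the edge ribbon;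
--  * vx x     : the corner joined to x by an arc of a vertex boundary
--               (between consecutive attaching arcs).
-- Vertices   = orbits of <swSide , vx>,
-- edges      = orbits of <swSide , swEnd>,
-- boundary components = orbits of <swEnd , vx>.

Flag : ℕ → Set
Flag m = Fin m × Bool × Bool

edgeOf : ∀ {m} → Flag m → Fin m
edgeOf (i , _ , _) = i

swSide : ∀ {m} → Flag m → Flag m
swSide (i , a , c) = (i , a , not c)

swEnd : ∀ {m} → Flag m → Flag m
swEnd (i , a , c) = (i , not a , c)

record RibbonGraph (m : ℕ) : Set where
  field
    vx       : Flag m → Flag m
    vx-invol : ∀ x → vx (vx x) ≡ x
    vx-fpf   : ∀ x → vx x ≢ x
open RibbonGraph public

conj : ∀ {m} (φ : Flag m → Flag m) → (∀ x → φ (φ x) ≡ x) →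
       RibbonGraph m → RibbonGraph m
conj φ φφ G = record
  { vx = λ x → φ (vx G (φ x))
  ; vx-invol = λ x → trans (cong φ (trans (cong (vx G) (φφ (vx G (φ x))))
                                           (vx-invol G (φ x))))
                            (φφ x)
  ; vx-fpf = λ x eq → vx-fpf G (φ x)
               (trans (sym (φφ (vx G (φ x)))) (cong φ eq))
  }

trOn : ∀ {m} → Subset m → Flag m → Flag m
trOn A (i , a , c) = if lookup A i then (i , c , a) else (i , a , c)

trOn-invol : ∀ {m} (A : Subset m) x → trOn A (trOn A x) ≡ x
trOn-invol A (i , a , c) with lookup A i in eq
... | true rewrite eq = refl
... | false rewrite eq = refl

tr : ∀ {m} → Flag m → Flag m
tr (i , a , c) = (i , c , a)

tr-invol : ∀ {m} (x : Flag m) → tr (tr x) ≡ x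
tr-invol (i , a , c) = refl

-- Geometric dual G*: vertex discs are glued to the boundary components
-- of G, so the ribbon sides of G become the attaching arcs of G* and
-- vice versa (swSide and swEnd exchange roles); edge i of G* is e*.
dual : ∀ {m} → RibbonGraph m → RibbonGraph m
dual = conj tr tr-invol

partialDual : ∀ {m} → RibbonGraph m → Subset m → RibbonGraph m
partialDual G A = conj (trOn A) (trOn-invol A) G

Connected : ∀ {m} → RibbonGraph m → Set
Connected G = ∀ x y →
  Star (λ a b → b ≡ swSide a ⊎ b ≡ swEnd a ⊎ b ≡ vx G a) x y

-- boundary of the spanning subgraph F_H: along edges of H it follows the
-- ribbon sides, along deleted edges it follows the attaching arcs.
τ : ∀ {m} → Subset m → Flag m → Flag m
τ H (i , a , c) = if lookup H i then (i , not a , c) else (i , a , not c)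

-- bc(F_H) = 1
IsQuasiTree : ∀ {m} → RibbonGraph m → Subset m → Set
IsQuasiTree G H = ∀ x y → Star (λ a b → b ≡ τ H a ⊎ b ≡ vx G a) x y

-- Loops of a one-vertex ribbon graph.  ρ walks around the boundary of
-- the vertex from the entry corner of one attaching arc to the entry
-- corner of the next; the 2m attaching arcs are met at steps 0..2m-1.

iter : ∀ {A : Set} → (A → A) → ℕ → A → A
iter f zero x = x
iter f (suc n) x = f (iter f n x)

ρ : ∀ {m} → RibbonGraph m → Flag m → Flag m
ρ G x = vx G (swSide x)

start : ∀ {m} → Fin m → Flag m
start e = (e , false , false)

walk : ∀ {m} → RibbonGraph m → Fin m → ℕ → Flag m
walk G e j = iter (ρ G) j (start e)

arcAt : ∀ {m} → RibbonGraph m → Fin m → ℕ → Fin m × Bool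
arcAt G e j with walk G e j
... | (i , a , _) = (i , a)

-- e and f link: the attaching arcs of e and f alternate around the vertex
Link : ∀ {m} → RibbonGraph m → Fin m → Fin m → Set
Link {m} G e f = e ≢ f × ∃[ p ] ∃[ q ] ∃[ r ]
  (p < 2 * m × q < 2 * m × r < 2 * m ×
   arcAt G e p ≡ (e , true) × arcAt G e q ≡ (f , false) ×
   arcAt G e r ≡ (f , true) ×
   ((q < p × p < r) ⊎ (r < p × p < q)))

-- e is an orientable loop: the ribbon sides join the entry corner of each
-- end to the exit corner of the other end (an annulus).
OrientableLoop : ∀ {m} → RibbonGraph m → Fin m → Set
OrientableLoop {m} G e = ∃[ p ] (p < 2 * m × walk G e p ≡ (e , true , true))

NonorientableLoop : ∀ {m} → RibbonGraph m → Fin m → Set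
NonorientableLoop {m} G e = ∃[ p ] (p < 2 * m × walk G e p ≡ (e , true , false))

-- Activities with respect to a quasi-tree Q and an order ≺, computed in
-- the one-vertex ribbon graph G^{E(Q)}.

module _ {m} (G : RibbonGraph m) (_≺_ : Rel (Fin m) 0ℓ) (Q : Subset m) where

  Live : Fin m → Set
  Live e = ∀ f → f ≺ e → ¬ Link (partialDual G Q) e f

  Dead : Fin m → Set
  Dead e = ¬ Live e

  DI Io In DE Eo En : Fin m → Set
  DI e = e ∈ Q × Dead e
  Io e = e ∈ Q × Live e × OrientableLoop (partialDual G Q) e
  In e = e ∈ Q × Live e × NonorientableLoop (partialDual G Q) e
  DE e = e ∉ Q × Dead e
  Eo e = e ∉ Q × Live e × OrientableLoop (partialDual G Q) e
  En e = e ∉ Q × Live e × NonorientableLoop (partialDual G Q) e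

module Submission where

-- All six activity classes of an edge e with respect to
-- a quasi-tree Q of G are read off from the one-vertex ribbon graph G^Q
-- (linking, and orientability of the loop e), together with whether e lies
-- in Q.  The heart of the matter is the partial-duality identity
--
--     (G*)^(E \ Q) = G^Q ,
--
-- which in the flag model says that the two graphs have literally the same
-- vertex-arc involution: dualising exchanges "end" and "side" on every edge,
-- and partially dualising G* on the complement of Q undoes this exactly on
-- the edges outside Q.  So
--   * first we show that walks, arcs, links and loop orientability depend
--     only on the vertex-arc involution, hence so do liveness and deadness;
--   * then we prove the identity above;
--   * finally, since e ∈ E \ Q iff e ∉ Q, internal classes of Q* match the
--     external classes of Q and vice versa, with equal liveness and loop type.

open import Defs
open import Level using (0ℓ)
open import Data.Nat using (zero; suc)
open import Data.Fin using (Fin)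
open import Data.Fin.Subset using (Subset; ∁; _∈_; _∉_)
open import Data.Fin.Subset.Properties using (x∈∁p⇒x∉p; x∉∁p⇒x∈p; x∉p⇒x∈∁p; x∈p⇒x∉∁p)
open import Data.Vec using (lookup)
open import Data.Vec.Properties using (lookup-map)
open import Data.Bool using (true; false; not)
open import Data.Product using (_×_; _,_)
open import Data.Product.Function.NonDependent.Propositional using (_×-⇔_)
open import Relation.Binary using (Rel; IsStrictTotalOrder)
open import Relation.Binary.PropositionalEquality
open import Function.Base using (_∘′_)
open import Function.Bundles using (_⇔_; mk⇔; Equivalence)

-- Two ribbon graphs on the same flags with the same vertex-arc involution,
-- i.e. the same "picture".  (A record, so that H and H′ can be inferred.)
record _≅ᵥ_ {m} (H H′ : RibbonGraph m) : Set where
  constructor same-vx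
  field vx-≡ : ∀ x → vx H x ≡ vx H′ x
open _≅ᵥ_

≅ᵥ-sym : ∀ {m} {H H′ : RibbonGraph m} → H ≅ᵥ H′ → H′ ≅ᵥ H
≅ᵥ-sym H≅H′ = same-vx λ x → sym (vx-≡ H≅H′ x)

module SamePicture {m} {H H′ : RibbonGraph m} (H≅H′ : H ≅ᵥ H′) where

  walk-cong : ∀ e j → walk H e j ≡ walk H′ e j
  walk-cong e zero    = refl
  walk-cong e (suc j) =
    trans (vx-≡ H≅H′ _) (cong (λ y → vx H′ (swSide y)) (walk-cong e j))

  arcAt-cong : ∀ e j → arcAt H e j ≡ arcAt H′ e j
  arcAt-cong e j with walk H e j | walk H′ e j | walk-cong e j
  ... | w | .w | refl = refl

  link-transfer : ∀ e f → Link H e f → Link H′ e f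
  link-transfer e f (e≢f , p , q , r , p< , q< , r< , arc-p , arc-q , arc-r , alt) =
    e≢f , p , q , r , p< , q< , r< ,
    trans (sym (arcAt-cong e p)) arc-p ,
    trans (sym (arcAt-cong e q)) arc-q ,
    trans (sym (arcAt-cong e r)) arc-r , alt

  orientable-transfer : ∀ e → OrientableLoop H e → OrientableLoop H′ e
  orientable-transfer e (p , p< , w) = p , p< , trans (sym (walk-cong e p)) w

  nonorientable-transfer : ∀ e → NonorientableLoop H e → NonorientableLoop H′ e
  nonorientable-transfer e (p , p< , w) = p , p< , trans (sym (walk-cong e p)) w

link⇔ : ∀ {m} {H H′ : RibbonGraph m} → H ≅ᵥ H′ → ∀ e f → Link H e f ⇔ Link H′ e f
link⇔ H≅H′ e f = mk⇔ (SamePicture.link-transfer H≅H′ e f)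
                      (SamePicture.link-transfer (≅ᵥ-sym H≅H′) e f)

orientable⇔ : ∀ {m} {H H′ : RibbonGraph m} → H ≅ᵥ H′ → ∀ e →
  OrientableLoop H e ⇔ OrientableLoop H′ e
orientable⇔ H≅H′ e = mk⇔ (SamePicture.orientable-transfer H≅H′ e)
                         (SamePicture.orientable-transfer (≅ᵥ-sym H≅H′) e)

nonorientable⇔ : ∀ {m} {H H′ : RibbonGraph m} → H ≅ᵥ H′ → ∀ e →
  NonorientableLoop H e ⇔ NonorientableLoop H′ e
nonorientable⇔ H≅H′ e = mk⇔ (SamePicture.nonorientable-transfer H≅H′ e)
                            (SamePicture.nonorientable-transfer (≅ᵥ-sym H≅H′) e)

module SameActivities {m} (G G′ : RibbonGraph m) (Q Q′ : Subset m) (_≺_ : Rel (Fin m) 0ℓ)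
         (same : partialDual G Q ≅ᵥ partialDual G′ Q′) where

  live⇔ : ∀ e → Live G _≺_ Q e ⇔ Live G′ _≺_ Q′ e
  live⇔ e = mk⇔ (λ live f f≺e link → live f f≺e (Equivalence.from (link⇔ same e f) link))
                (λ live f f≺e link → live f f≺e (Equivalence.to (link⇔ same e f) link))

  dead⇔ : ∀ e → Dead G _≺_ Q e ⇔ Dead G′ _≺_ Q′ e
  dead⇔ e = mk⇔ (λ dead live → dead (Equivalence.from (live⇔ e) live))
                (λ dead live → dead (Equivalence.to (live⇔ e) live))

  module _ {e : Fin m} {A B : Set} (A⇔B : A ⇔ B) where

    dead-class⇔ : (A × Dead G _≺_ Q e) ⇔ (B × Dead G′ _≺_ Q′ e)
    dead-class⇔ = A⇔B ×-⇔ dead⇔ e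

    orientable-class⇔ :
      (A × Live G _≺_ Q e × OrientableLoop (partialDual G Q) e) ⇔
      (B × Live G′ _≺_ Q′ e × OrientableLoop (partialDual G′ Q′) e)
    orientable-class⇔ = A⇔B ×-⇔ (live⇔ e ×-⇔ orientable⇔ same e)

    nonorientable-class⇔ :
      (A × Live G _≺_ Q e × NonorientableLoop (partialDual G Q) e) ⇔
      (B × Live G′ _≺_ Q′ e × NonorientableLoop (partialDual G′ Q′) e)
    nonorientable-class⇔ = A⇔B ×-⇔ (live⇔ e ×-⇔ nonorientable⇔ same e)

∈∁⇔∉ : ∀ {m} {Q : Subset m} {e} → e ∈ ∁ Q ⇔ e ∉ Q
∈∁⇔∉ = mk⇔ x∈∁p⇒x∉p x∉p⇒x∈∁p

∉∁⇔∈ : ∀ {m} {Q : Subset m} {e} → e ∉ ∁ Q ⇔ e ∈ Q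
∉∁⇔∈ = mk⇔ x∉∁p⇒x∈p x∈p⇒x∉∁p

tr-then-trOn∁ : ∀ {m} (Q : Subset m) x → trOn (∁ Q) (tr x) ≡ trOn Q x
tr-then-trOn∁ Q (i , a , c) rewrite lookup-map i not Q with lookup Q i
... | true  = refl
... | false = refl

trOn∁-then-tr : ∀ {m} (Q : Subset m) x → tr (trOn (∁ Q) x) ≡ trOn Q x
trOn∁-then-tr Q (i , a , c) rewrite lookup-map i not Q with lookup Q i
... | true  = refl
... | false = refl

partialDual-dual-∁ : ∀ {m} (G : RibbonGraph m) (Q : Subset m) →
  partialDual (dual G) (∁ Q) ≅ᵥ partialDual G Q
partialDual-dual-∁ G Q = same-vx λ x → begin
  trOn (∁ Q) (tr (vx G (tr (trOn (∁ Q) x)))) ≡⟨ tr-then-trOn∁ Q _ ⟩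
  trOn Q (vx G (tr (trOn (∁ Q) x)))          ≡⟨ cong (trOn Q ∘′ vx G) (trOn∁-then-tr Q x) ⟩
  trOn Q (vx G (trOn Q x))                   ∎
  where
  open ≡-Reasoning

lemma4p1 : ∀ {m} (G : RibbonGraph m) → Connected G →
    (_≺_ : Rel (Fin m) 0ℓ) → IsStrictTotalOrder _≡_ _≺_ →
    (Q : Subset m) → IsQuasiTree G Q →
    (∀ e →
      (DI (dual G) _≺_ (∁ Q) e ⇔ DE G _≺_ Q e) ×
      (Io (dual G) _≺_ (∁ Q) e ⇔ Eo G _≺_ Q e) ×
      (In (dual G) _≺_ (∁ Q) e ⇔ En G _≺_ Q e) ×
      (DE (dual G) _≺_ (∁ Q) e ⇔ DI G _≺_ Q e) ×
      (Eo (dual G) _≺_ (∁ Q) e ⇔ Io G _≺_ Q e) ×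
      (En (dual G) _≺_ (∁ Q) e ⇔ In G _≺_ Q e))
lemma4p1 G _ _≺_ _ Q _ e =
  dead-class⇔ ∈∁⇔∉ ,
  orientable-class⇔ ∈∁⇔∉ ,
  nonorientable-class⇔ ∈∁⇔∉ ,
  dead-class⇔ ∉∁⇔∈ ,
  orientable-class⇔ ∉∁⇔∈ ,
  nonorientable-class⇔ ∉∁⇔∈
  where open SameActivities (dual G) G (∁ Q) Q _≺_ (partialDual-dual-∁ G Q)
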